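{- The relation $\succeq$ is not complete in general: there exists a game ladder $(N,T,f)$ and two players $p,q\in N$ such that neither $p\succeq q$ nor $q\succeq p$.
   Context: A game ladder is a triple $(N,T,f)$ where $N=\{1,\dots,n\}$ is a non-empty finite set of players, $T=\{1,\dots,j\}$ with $j\ge 2$ is an ordered set of positions (higher index = more important position), and $f:T^N\to\mathbb{R}$ is monotonic: for all $x,z\in T^N$ with $x\le z$ componentwise, $f(x)\le f(z)$. For $p\in N$, $e^p$ denotes the $p$-th unit vector. For players $p,q$ and positions $r>s$ in $T$, write $p\succeq_{(r,s)}q$ if for every $x\in T^N$ with $x_p=x_q=s$ one has $f(x+(r-s)e^p)\ge f(x+(r-s)e^q)$. Write $p\succeq q$ if $p\succeq_{(r,s)}q$ for all $r,s\in T$ with $r>s$. -}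

module Defs where

open import Data.Nat using (ℕ; _≤_)
open import Data.Fin as Fin using (Fin; _≟_)
open import Data.Rational as ℚ using (ℚ)
open import Data.Product using (Σ; _×_)
open import Relation.Binary.PropositionalEquality using (_≡_)
open import Relation.Nullary using (¬_; yes; no)

-- Players N = {1..n} are Fin n, positions T = {1..j} are Fin j
-- (ordered by Fin's _<_ / _≤_, i.e. by toℕ). A profile x ∈ T^N is a
-- function Fin n → Fin j.
Profile : ℕ → ℕ → Set
Profile n j = Fin n → Fin j

_≤ᴾ_ : ∀ {n j} → Profile n j → Profile n j → Set
x ≤ᴾ z = ∀ p → x p Fin.≤ z p

Monotone : ∀ {n j} → (Profile n j → ℚ) → Set
Monotone {n} {j} f = ∀ (x z : Profile n j) → x ≤ᴾ z → f x ℚ.≤ f z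

-- A game ladder (N, T, f): N non-empty, |T| ≥ 2, f monotone.
-- (The codomain ℝ is replaced by ℚ.)
record GameLadder : Set where
  field
    n        : ℕ
    j        : ℕ
    n≥1      : 1 ≤ n
    j≥2      : 2 ≤ j
    f        : Profile n j → ℚ
    monotone : Monotone f

-- x + (r - s) e^p, applied to a profile with x_p = s: the p-th
-- coordinate becomes r, all others unchanged.
raise : ∀ {n j} → Profile n j → Fin n → Fin j → Profile n j
raise x p r i with i ≟ p
... | yes _ = r
... | no  _ = x i

DominatesAt : (G : GameLadder) → (p q : Fin (GameLadder.n G))
            → (r s : Fin (GameLadder.j G)) → Set
DominatesAt G p q r s =
  ∀ (x : Profile n j) → x p ≡ s → x q ≡ s →
    f (raise x q r) ℚ.≤ f (raise x p r)
  where open GameLadder G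

Dominates : (G : GameLadder) → (p q : Fin (GameLadder.n G)) → Set
Dominates G p q =
  ∀ (r s : Fin (GameLadder.j G)) → s Fin.< r → DominatesAt G p q r s

-- Give the two players additively separable rewards: player 0 only gains
-- from reaching the top position, player 1 already gains from the middle
-- one (but less). Starting from both players at the bottom, promoting
-- player 1 to the middle beats promoting player 0 there, while promoting
-- player 0 to the top beats promoting player 1 there.
module Submission where

open import Defs
open import Data.Fin as Fin using (Fin; zero; suc; toℕ)
open import Data.Nat as ℕ using (ℕ; z≤n; s≤s)
open import Data.Nat.Properties as ℕP using ()
open import Data.Product using (Σ; _×_; _,_)
open import Data.Rational as ℚ using (ℚ; 0ℚ; 1ℚ)
open import Data.Rational.Properties as ℚP using ()
open import Relation.Binary.Core using (_Preserves_⟶_)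
open import Relation.Binary.PropositionalEquality using (_≡_; refl)
open import Relation.Nullary using (¬_; yes; no; contradiction)
open import Relation.Nullary.Decidable using (True; toWitness)

threshold : ∀ {j} → ℚ → ℕ → Fin j → ℚ
threshold c t a with t ℕ.≤? toℕ a
... | yes _ = c
... | no  _ = 0ℚ

threshold-mono : ∀ {j} {c} t → 0ℚ ℚ.≤ c →
                 threshold {j} c t Preserves Fin._≤_ ⟶ ℚ._≤_
threshold-mono t 0≤c {a} {b} a≤b with t ℕ.≤? toℕ a | t ℕ.≤? toℕ b
... | yes _   | yes _   = ℚP.≤-refl
... | yes t≤a | no  t≰b = contradiction (ℕP.≤-trans t≤a a≤b) t≰b
... | no  _   | yes _   = 0≤c
... | no  _   | no  _   = ℚP.≤-refl

separable : ∀ {j} → (Fin j → ℚ) → (Fin j → ℚ) → Profile 2 j → ℚ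
separable g h x = g (x zero) ℚ.+ h (x (suc zero))

separable-monotone : ∀ {j} {g h : Fin j → ℚ} →
                     g Preserves Fin._≤_ ⟶ ℚ._≤_ → h Preserves Fin._≤_ ⟶ ℚ._≤_ →
                     Monotone (separable g h)
separable-monotone g-mono h-mono x z x≤z =
  ℚP.+-mono-≤ (g-mono (x≤z zero)) (h-mono (x≤z (suc zero)))

¬dominatesAt : ∀ G p q r s (x : Profile (GameLadder.n G) (GameLadder.j G)) →
               x p ≡ s → x q ≡ s →
               GameLadder.f G (raise x p r) ℚ.< GameLadder.f G (raise x q r) →
               ¬ DominatesAt G p q r s
¬dominatesAt G p q r s x xp≡s xq≡s p<q p⪰q =
  ℚP.<-irrefl refl (ℚP.<-≤-trans p<q (p⪰q x xp≡s xq≡s))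

<-fromDecision : (a b : ℚ) → {True (a ℚP.<? b)} → a ℚ.< b
<-fromDecision a b {a<b} = toWitness a<b

-- toℕ counts positions from 0: late pays only at the top, early from the middle on.
late : Fin 3 → ℚ
late = threshold (1ℚ ℚ.+ 1ℚ) 2

early : Fin 3 → ℚ
early = threshold 1ℚ 1

ladder : GameLadder
ladder = record
  { n = 2 ; j = 3 ; n≥1 = s≤s z≤n ; j≥2 = s≤s (s≤s z≤n)
  ; f = separable late early
  ; monotone = separable-monotone (threshold-mono 2 (ℚP.nonNegative⁻¹ _))
                                  (threshold-mono 1 (ℚP.nonNegative⁻¹ _)) }

bottom : Profile 2 3
bottom _ = zero

proposition2 : Σ GameLadder λ G → Σ (Fin (GameLadder.n G)) λ p → Σ (Fin (GameLadder.n G)) λ q →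
    (¬ Dominates G p q) × (¬ Dominates G q p)
proposition2 = ladder , zero , suc zero , ¬0⪰1 , ¬1⪰0
  where
  ¬0⪰1 : ¬ Dominates ladder zero (suc zero)
  ¬0⪰1 d = ¬dominatesAt ladder zero (suc zero) (suc zero) zero bottom refl refl
             (<-fromDecision _ _) (d (suc zero) zero (s≤s z≤n))

  ¬1⪰0 : ¬ Dominates ladder (suc zero) zero
  ¬1⪰0 d = ¬dominatesAt ladder (suc zero) zero (suc (suc zero)) zero bottom refl refl
             (<-fromDecision _ _) (d (suc (suc zero)) zero (s≤s z≤n))
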